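{- Let $n\ge 2$ be an integer and let $f(x)$ be a polynomial with integer coefficients such that $f(m)>0$ for all positive integers $m$. Then: (i) for every integer $k$ with $1\le k\le n-1$, $H^*_{k+1,f}(n)<H^*_{1,f}(n)\,H^*_{k,f}(n)$; (ii) if $H^*_{1,f}(n)<1$, then $0<H^*_{k,f}(n)<1$ for all integers $k$ with $1\le k\le n$.
   Context: For integers $1\le k\le n$ and a polynomial $f$ with integer coefficients and $f(m)\ne 0$ for all positive integers $m$, define the multiple harmonic star sum $$H^*_{k,f}(n)=\sum_{1\le i_1\le\cdots\le i_k\le n}\prod_{j=1}^k\frac{1}{f(i_j)}.$$ -}

module Defs where

open import Data.Nat as ℕ using (ℕ; zero; suc)
open import Data.Nat.Properties using (≤-totalOrder; _≤?_)
open import Data.Integer as ℤ using (ℤ; +_; -[1+_]; +[1+_])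
open import Data.Rational as ℚ using (ℚ; _/_)
open import Data.List using (List; []; _∷_; map; concatMap; filter; upTo; foldr)
open import Data.List.Relation.Unary.Sorted.TotalOrder ≤-totalOrder using (Sorted; sorted?)

-- A polynomial with integer coefficients, given by its coefficient list
-- [a₀, a₁, …, a_d]  (f(x) = a₀ + a₁ x + … + a_d x^d).
Poly : Set
Poly = List ℤ

eval : Poly → ℤ → ℤ
eval []       x = + 0
eval (a ∷ as) x = a ℤ.+ x ℤ.* eval as x

-- Reciprocal of an integer as a rational number.  (Total; the value at 0
-- is a junk value 0, never used since f(m) ≠ 0 for the relevant m.)
recipℤ : ℤ → ℚ
recipℤ (+ zero)   = ℚ.0ℚ
recipℤ +[1+ n ]   = (+ 1) / suc n
recipℤ -[1+ n ]   = ℤ.-[1+ 0 ] / suc n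

range1 : ℕ → List ℕ
range1 n = map suc (upTo n)

tuples : ℕ → ℕ → List (List ℕ)
tuples zero    n = [] ∷ []
tuples (suc k) n = concatMap (λ i → map (i ∷_) (tuples k n)) (range1 n)

ndTuples : ℕ → ℕ → List (List ℕ)
ndTuples k n = filter (sorted? _≤?_) (tuples k n)

sumℚ : List ℚ → ℚ
sumℚ = foldr ℚ._+_ ℚ.0ℚ

prodℚ : List ℚ → ℚ
prodℚ = foldr ℚ._*_ ℚ.1ℚ

Hstar : ℕ → Poly → ℕ → ℚ
Hstar k f n = sumℚ (map (λ is → prodℚ (map (λ i → recipℤ (eval f (+ i))) is)) (ndTuples k n))

{-# OPTIONS --safe #-}
module Submission where

-- Splitting off the first index, H*_{k+1}(n) = Σᵢ (1/f(i))·Sᵢ, where Sᵢ sums over the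
-- non-decreasing k-tuples with all entries ≥ i.  Each Sᵢ ≤ H*_k(n), strictly for i = n ≥ 2
-- since the tuple (1, …, 1) is missing from Sₙ; this is (i).  For (ii), H*_{k+1} ≤ H*_1·H*_k ≤ H*_k
-- gives H*_k ≤ H*_1 < 1, and (1, …, 1) again witnesses positivity.  Only the positivity of the
-- weights 1/f(i) is used, not the upper bounds on k.

open import Defs
open import Data.Nat using (ℕ; suc; _≤_; _∸_)
open import Data.Integer using (+_)
open import Data.Product using (_×_)
import Data.Integer as ℤ
import Data.Rational as ℚ

open import Data.Nat using (zero; z≤n; s≤s)
open import Data.Nat.Properties as ℕP using (_≤?_; ≤-totalOrder; ≤-refl)
open import Data.Product using (_,_)
open import Data.Rational using (ℚ; 0ℚ; 1ℚ; _+_; _*_; _<_; positive; nonNegative)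
open import Data.Rational.Properties as ℚP using (module ≤-Reasoning)
open import Data.List using (List; []; _∷_; _++_; map; filter; concatMap; replicate; upTo)
open import Data.List.Properties using (filter-++; filter-none; map-++; map-∘)
open import Data.List.Relation.Unary.All as All using (All; []; _∷_)
import Data.List.Relation.Unary.All.Properties as All
open import Data.List.Relation.Unary.Any using (here; there)
import Data.List.Relation.Unary.Any as Any
import Data.List.Relation.Unary.Any.Properties as Any
open import Data.List.Relation.Unary.Linked as Linked using ([]; [-]; _∷_)
open import Data.List.Membership.Propositional using (_∈_)
open import Data.List.Membership.Propositional.Properties using (∈-upTo⁺)
open import Data.List.Relation.Unary.Sorted.TotalOrder ≤-totalOrder using (Sorted; sorted?)
open import Level using (0ℓ)
open import Relation.Nullary using (yes; no; ¬_; contradiction)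
open import Relation.Unary using (Pred; Decidable; _⊆_)
open import Relation.Unary.Properties using (∅?)
open import Relation.Binary.PropositionalEquality using (_≡_; refl; sym; trans; cong; cong₂; subst; module ≡-Reasoning)

sumℚ-++ : (xs ys : List ℚ) → sumℚ (xs ++ ys) ≡ sumℚ xs + sumℚ ys
sumℚ-++ []       ys = sym (ℚP.+-identityˡ _)
sumℚ-++ (x ∷ xs) ys = trans (cong (_+_ x) (sumℚ-++ xs ys)) (sym (ℚP.+-assoc x _ _))

*-distribˡ-sumℚ : (c : ℚ) (xs : List ℚ) → c * sumℚ xs ≡ sumℚ (map (c *_) xs)
*-distribˡ-sumℚ c []       = ℚP.*-zeroʳ c
*-distribˡ-sumℚ c (x ∷ xs) = trans (ℚP.*-distribˡ-+ c x _) (cong (_+_ (c * x)) (*-distribˡ-sumℚ c xs))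

*-distribʳ-sumℚ : (c : ℚ) (xs : List ℚ) → sumℚ xs * c ≡ sumℚ (map (_* c) xs)
*-distribʳ-sumℚ c []       = ℚP.*-zeroˡ c
*-distribʳ-sumℚ c (x ∷ xs) = trans (ℚP.*-distribʳ-+ c x _) (cong (_+_ (x * c)) (*-distribʳ-sumℚ c xs))

module _ {A : Set} where

  sumℚ-cong : {a b : A → ℚ} (xs : List A) → (∀ x → a x ≡ b x) → sumℚ (map a xs) ≡ sumℚ (map b xs)
  sumℚ-cong []       _   = refl
  sumℚ-cong (x ∷ xs) a≡b = cong₂ _+_ (a≡b x) (sumℚ-cong xs a≡b)

  sumℚ-mono-≤ : {a b : A → ℚ} {xs : List A} → All (λ x → a x ℚ.≤ b x) xs
              → sumℚ (map a xs) ℚ.≤ sumℚ (map b xs)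
  sumℚ-mono-≤ []         = ℚP.≤-refl
  sumℚ-mono-≤ (ax≤bx ∷ ≤s) = ℚP.+-mono-≤ ax≤bx (sumℚ-mono-≤ ≤s)

  sumℚ-mono-< : {a b : A → ℚ} {xs : List A} {y : A} → All (λ x → a x ℚ.≤ b x) xs
              → y ∈ xs → a y < b y → sumℚ (map a xs) < sumℚ (map b xs)
  sumℚ-mono-< (_ ∷ ≤s)     (here refl) ay<by = ℚP.+-mono-<-≤ ay<by (sumℚ-mono-≤ ≤s)
  sumℚ-mono-< (ax≤bx ∷ ≤s) (there y∈xs) ay<by = ℚP.+-mono-≤-< ax≤bx (sumℚ-mono-< ≤s y∈xs ay<by)

  filter-map : {B : Set} {P : Pred B 0ℓ} (P? : Decidable P) (h : A → B) (xs : List A)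
             → filter P? (map h xs) ≡ map h (filter (λ x → P? (h x)) xs)
  filter-map P? h []       = refl
  filter-map P? h (x ∷ xs) with P? (h x)
  ... | yes _ = cong (h x ∷_) (filter-map P? h xs)
  ... | no  _ = filter-map P? h xs

module FilteredSum {A : Set} (g : A → ℚ) where

  filteredSum : {P : Pred A 0ℓ} → Decidable P → List A → ℚ
  filteredSum P? xs = sumℚ (map g (filter P? xs))

  module _ {P Q : Pred A 0ℓ} (P? : Decidable P) (Q? : Decidable Q) (P⊆Q : P ⊆ Q) where

    filteredSum-mono-≤ : {xs : List A} → All (λ x → 0ℚ ℚ.≤ g x) xs
                       → filteredSum P? xs ℚ.≤ filteredSum Q? xs
    filteredSum-mono-≤ {[]}     []           = ℚP.≤-refl
    filteredSum-mono-≤ {x ∷ xs} (0≤gx ∷ 0≤g) with P? x | Q? x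
    ... | yes _  | yes _  = ℚP.+-monoʳ-≤ (g x) (filteredSum-mono-≤ 0≤g)
    ... | yes Px | no ¬Qx = contradiction (P⊆Q Px) ¬Qx
    ... | no _   | yes _  = subst (ℚ._≤ g x + _) (ℚP.+-identityˡ _) (ℚP.+-mono-≤ 0≤gx (filteredSum-mono-≤ 0≤g))
    ... | no _   | no _   = filteredSum-mono-≤ 0≤g

    filteredSum-mono-< : {xs : List A} {y : A} → All (λ x → 0ℚ ℚ.≤ g x) xs
                       → y ∈ xs → Q y → ¬ P y → 0ℚ < g y
                       → filteredSum P? xs < filteredSum Q? xs
    filteredSum-mono-< {x ∷ xs} (0≤gx ∷ 0≤g) (here refl) Qx ¬Px 0<gx with P? x | Q? x
    ... | yes Px | _      = contradiction Px ¬Px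
    ... | no _   | no ¬Qx = contradiction Qx ¬Qx
    ... | no _   | yes _  = subst (_< g x + _) (ℚP.+-identityˡ _) (ℚP.+-mono-<-≤ 0<gx (filteredSum-mono-≤ 0≤g))
    filteredSum-mono-< {x ∷ xs} (0≤gx ∷ 0≤g) (there y∈xs) Qy ¬Py 0<gy with P? x | Q? x
    ... | yes _  | yes _  = ℚP.+-monoʳ-< (g x) (filteredSum-mono-< 0≤g y∈xs Qy ¬Py 0<gy)
    ... | yes Px | no ¬Qx = contradiction (P⊆Q Px) ¬Qx
    ... | no _   | yes _  = subst (_< g x + _) (ℚP.+-identityˡ _) (ℚP.+-mono-≤-< 0≤gx (filteredSum-mono-< 0≤g y∈xs Qy ¬Py 0<gy))
    ... | no _   | no _   = filteredSum-mono-< 0≤g y∈xs Qy ¬Py 0<gy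

  filteredSum-∅ : (xs : List A) → filteredSum ∅? xs ≡ 0ℚ
  filteredSum-∅ xs = cong (λ ys → sumℚ (map g ys)) (filter-none ∅? (All.universal (λ _ ()) xs))

  module _ {Q : Pred A 0ℓ} (Q? : Decidable Q) where

    filteredSum-nonNeg : {xs : List A} → All (λ x → 0ℚ ℚ.≤ g x) xs → 0ℚ ℚ.≤ filteredSum Q? xs
    filteredSum-nonNeg {xs} 0≤g = subst (ℚ._≤ filteredSum Q? xs) (filteredSum-∅ xs) (filteredSum-mono-≤ ∅? Q? (λ ()) 0≤g)

    filteredSum-pos : {xs : List A} {y : A} → All (λ x → 0ℚ ℚ.≤ g x) xs
                    → y ∈ xs → Q y → 0ℚ < g y → 0ℚ < filteredSum Q? xs
    filteredSum-pos {xs} 0≤g y∈xs Qy 0<gy =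
      subst (_< filteredSum Q? xs) (filteredSum-∅ xs) (filteredSum-mono-< ∅? Q? (λ ()) 0≤g y∈xs Qy (λ ()) 0<gy)

    filteredSum-concatMap : {B : Set} (h : B → List A) (ys : List B)
                          → filteredSum Q? (concatMap h ys) ≡ sumℚ (map (λ y → filteredSum Q? (h y)) ys)
    filteredSum-concatMap h []       = refl
    filteredSum-concatMap h (y ∷ ys) = begin
      sumℚ (map g (filter Q? (h y ++ concatMap h ys)))
        ≡⟨ cong (λ zs → sumℚ (map g zs)) (filter-++ Q? (h y) (concatMap h ys)) ⟩
      sumℚ (map g (filter Q? (h y) ++ filter Q? (concatMap h ys)))
        ≡⟨ cong sumℚ (map-++ g (filter Q? (h y)) _) ⟩
      sumℚ (map g (filter Q? (h y)) ++ map g (filter Q? (concatMap h ys)))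
        ≡⟨ sumℚ-++ (map g (filter Q? (h y))) _ ⟩
      filteredSum Q? (h y) + filteredSum Q? (concatMap h ys)
        ≡⟨ cong (_+_ (filteredSum Q? (h y))) (filteredSum-concatMap h ys) ⟩
      sumℚ (map (λ y → filteredSum Q? (h y)) (y ∷ ys)) ∎
      where open ≡-Reasoning

    filteredSum-map : {B : Set} (h : B → A) (ys : List B)
                    → filteredSum Q? (map h ys) ≡ sumℚ (map (λ y → g (h y)) (filter (λ y → Q? (h y)) ys))
    filteredSum-map h ys = cong sumℚ (trans (cong (map g) (filter-map Q? h ys)) (sym (map-∘ _)))

∈-range1 : {i n : ℕ} → 1 ≤ i → i ≤ n → i ∈ range1 n
∈-range1 {suc j} _ j<n = Any.map⁺ (Any.map (cong suc) (∈-upTo⁺ j<n))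

range1-≥1 : (n : ℕ) → All (1 ≤_) (range1 n)
range1-≥1 n = All.map⁺ (All.universal (λ _ → s≤s z≤n) (upTo n))

tuples-≥1 : (k n : ℕ) → All (All (1 ≤_)) (tuples k n)
tuples-≥1 zero    n = [] ∷ []
tuples-≥1 (suc k) n = All.concat⁺ (All.map⁺ (All.map
  (λ 1≤i → All.map⁺ (All.map (1≤i ∷_) (tuples-≥1 k n))) (range1-≥1 n)))

replicate∈tuples : {i n : ℕ} (k : ℕ) → i ∈ range1 n → replicate k i ∈ tuples k n
replicate∈tuples zero    i∈range = here refl
replicate∈tuples (suc k) i∈range = Any.concat⁺ (Any.map⁺ (Any.map
  (λ { refl → Any.map⁺ (Any.map (cong (_ ∷_)) (replicate∈tuples k i∈range)) }) i∈range))

replicate-sorted : (k i : ℕ) → Sorted (replicate k i)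
replicate-sorted zero          i = []
replicate-sorted (suc zero)    i = [-]
replicate-sorted (suc (suc k)) i = ≤-refl ∷ replicate-sorted (suc k) i

recipℤ-pos : {z : ℤ.ℤ} → + 0 ℤ.< z → 0ℚ < recipℤ z
recipℤ-pos {+ zero}     (ℤ.+<+ ())
recipℤ-pos {ℤ.+[1+ m ]} _ = ℚP.positive⁻¹ _ {{ℚP.normalize-pos 1 (suc m)}}

module StarSum (w : ℕ → ℚ) (w-pos : {i : ℕ} → 1 ≤ i → 0ℚ < w i) where

  weight : List ℕ → ℚ
  weight t = prodℚ (map w t)

  open FilteredSum weight

  starSum : ℕ → ℕ → ℚ
  starSum k n = filteredSum (sorted? _≤?_) (tuples k n)

  starSumFrom : ℕ → ℕ → ℕ → ℚ
  starSumFrom i k n = filteredSum (λ t → sorted? _≤?_ (i ∷ t)) (tuples k n)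

  weight-pos : {t : List ℕ} → All (1 ≤_) t → 0ℚ < weight t
  weight-pos []                = ℚP.positive⁻¹ 1ℚ
  weight-pos {i ∷ t} (1≤i ∷ 1≤t) =
    ℚP.positive⁻¹ _ {{ℚP.pos*pos⇒pos (w i) {{positive (w-pos 1≤i)}} (weight t) {{positive (weight-pos 1≤t)}}}}

  tuples-weight-nonNeg : (k n : ℕ) → All (λ t → 0ℚ ℚ.≤ weight t) (tuples k n)
  tuples-weight-nonNeg k n = All.map (λ 1≤t → ℚP.<⇒≤ (weight-pos 1≤t)) (tuples-≥1 k n)

  starSum-suc : (k n : ℕ) → starSum (suc k) n ≡ sumℚ (map (λ i → w i * starSumFrom i k n) (range1 n))
  starSum-suc k n = begin
    starSum (suc k) n
      ≡⟨ filteredSum-concatMap (sorted? _≤?_) (λ i → map (i ∷_) (tuples k n)) (range1 n) ⟩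
    sumℚ (map (λ i → filteredSum (sorted? _≤?_) (map (i ∷_) (tuples k n))) (range1 n))
      ≡⟨ sumℚ-cong (range1 n) (λ i → trans (filteredSum-map (sorted? _≤?_) (i ∷_) (tuples k n))
                                          (trans (cong sumℚ (map-∘ (ts i))) (sym (*-distribˡ-sumℚ (w i) (map weight (ts i)))))) ⟩
    sumℚ (map (λ i → w i * starSumFrom i k n) (range1 n)) ∎
    where
      open ≡-Reasoning
      ts : ℕ → List (List ℕ)
      ts i = filter (λ t → sorted? _≤?_ (i ∷ t)) (tuples k n)

  starSumFrom-zero : (i n : ℕ) → starSumFrom i 0 n ≡ 1ℚ
  starSumFrom-zero i n = ℚP.+-identityʳ 1ℚ

  starSum-one-* : (n : ℕ) (c : ℚ) → starSum 1 n * c ≡ sumℚ (map (λ i → w i * c) (range1 n))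
  starSum-one-* n c = begin
    starSum 1 n * c                                                   ≡⟨ cong (_* c) (starSum-suc 0 n) ⟩
    sumℚ (map (λ i → w i * starSumFrom i 0 n) (range1 n)) * c            ≡⟨ *-distribʳ-sumℚ c (map (λ i → w i * starSumFrom i 0 n) (range1 n)) ⟩
    sumℚ (map (_* c) (map (λ i → w i * starSumFrom i 0 n) (range1 n)))  ≡⟨ cong sumℚ (sym (map-∘ (range1 n))) ⟩
    sumℚ (map (λ i → w i * starSumFrom i 0 n * c) (range1 n))           ≡⟨ sumℚ-cong (range1 n) (λ i → cong (λ x → w i * x * c) (starSumFrom-zero i n)) ⟩
    sumℚ (map (λ i → w i * 1ℚ * c) (range1 n))                         ≡⟨ sumℚ-cong (range1 n) (λ i → cong (_* c) (ℚP.*-identityʳ (w i))) ⟩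
    sumℚ (map (λ i → w i * c) (range1 n))                              ∎
    where open ≡-Reasoning

  starSumFrom-≤ : (i k n : ℕ) → starSumFrom i k n ℚ.≤ starSum k n
  starSumFrom-≤ i k n = filteredSum-mono-≤ _ (sorted? _≤?_) Linked.tail (tuples-weight-nonNeg k n)

  starSumFrom-< : (i k n : ℕ) → 2 ≤ i → 1 ≤ n → starSumFrom i (suc k) n < starSum (suc k) n
  starSumFrom-< i k n 2≤i 1≤n = filteredSum-mono-< _ (sorted? _≤?_) Linked.tail (tuples-weight-nonNeg (suc k) n)
    (replicate∈tuples (suc k) (∈-range1 ≤-refl 1≤n)) (replicate-sorted (suc k) 1)
    (λ sorted → ℕP.<⇒≱ 2≤i (Linked.head sorted)) (weight-pos (All.replicate⁺ (suc k) ≤-refl))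

  starSum-pos : (k n : ℕ) → 1 ≤ n → 0ℚ < starSum k n
  starSum-pos k n 1≤n = filteredSum-pos (sorted? _≤?_) (tuples-weight-nonNeg k n)
    (replicate∈tuples k (∈-range1 ≤-refl 1≤n)) (replicate-sorted k 1) (weight-pos (All.replicate⁺ k ≤-refl))

  starSum-nonNeg : (k n : ℕ) → 0ℚ ℚ.≤ starSum k n
  starSum-nonNeg k n = filteredSum-nonNeg (sorted? _≤?_) (tuples-weight-nonNeg k n)

  w-starSumFrom-≤ : (k n : ℕ) → All (λ i → w i * starSumFrom i k n ℚ.≤ w i * starSum k n) (range1 n)
  w-starSumFrom-≤ k n = All.map (λ {i} 1≤i →
    ℚP.*-monoˡ-≤-nonNeg (w i) {{nonNegative (ℚP.<⇒≤ (w-pos 1≤i))}} (starSumFrom-≤ i k n)) (range1-≥1 n)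

  starSum-suc-≤ : (k n : ℕ) → starSum (suc k) n ℚ.≤ starSum 1 n * starSum k n
  starSum-suc-≤ k n = begin
    starSum (suc k) n                                    ≡⟨ starSum-suc k n ⟩
    sumℚ (map (λ i → w i * starSumFrom i k n) (range1 n)) ≤⟨ sumℚ-mono-≤ (w-starSumFrom-≤ k n) ⟩
    sumℚ (map (λ i → w i * starSum k n) (range1 n))       ≡⟨ sym (starSum-one-* n (starSum k n)) ⟩
    starSum 1 n * starSum k n                            ∎
    where open ≤-Reasoning

  starSum-suc-< : (k n : ℕ) → 2 ≤ n → starSum (suc (suc k)) n < starSum 1 n * starSum (suc k) n
  starSum-suc-< k n 2≤n = begin-strict
    starSum (suc (suc k)) n                                         ≡⟨ starSum-suc (suc k) n ⟩
    sumℚ (map (λ i → w i * starSumFrom i (suc k) n) (range1 n))      <⟨ sumℚ-mono-< (w-starSumFrom-≤ (suc k) n) n∈range last-term-< ⟩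
    sumℚ (map (λ i → w i * starSum (suc k) n) (range1 n))            ≡⟨ sym (starSum-one-* n (starSum (suc k) n)) ⟩
    starSum 1 n * starSum (suc k) n                                 ∎
    where
      open ≤-Reasoning
      1≤n : 1 ≤ n
      1≤n = ℕP.<⇒≤ 2≤n
      n∈range : n ∈ range1 n
      n∈range = ∈-range1 1≤n ≤-refl
      last-term-< : w n * starSumFrom n (suc k) n < w n * starSum (suc k) n
      last-term-< = ℚP.*-monoʳ-<-pos (w n) {{positive (w-pos 1≤n)}} (starSumFrom-< n k n 2≤n 1≤n)

  starSum-≤-starSum-one : (k n : ℕ) → starSum 1 n ℚ.≤ 1ℚ → starSum (suc k) n ℚ.≤ starSum 1 n
  starSum-≤-starSum-one zero    n H₁≤1 = ℚP.≤-refl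
  starSum-≤-starSum-one (suc k) n H₁≤1 = begin
    starSum (suc (suc k)) n          ≤⟨ starSum-suc-≤ (suc k) n ⟩
    starSum 1 n * starSum (suc k) n  ≤⟨ ℚP.*-monoʳ-≤-nonNeg (starSum (suc k) n) {{nonNegative (starSum-nonNeg (suc k) n)}} H₁≤1 ⟩
    1ℚ * starSum (suc k) n           ≡⟨ ℚP.*-identityˡ (starSum (suc k) n) ⟩
    starSum (suc k) n                ≤⟨ starSum-≤-starSum-one k n H₁≤1 ⟩
    starSum 1 n                      ∎
    where open ≤-Reasoning

lemma2p1 : (n : ℕ) → 2 ≤ n → (f : Poly)
         → ((m : ℕ) → 1 ≤ m → + 0 ℤ.< eval f (+ m))
         → ((k : ℕ) → 1 ≤ k → k ≤ n ∸ 1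
              → Hstar (suc k) f n ℚ.< Hstar 1 f n ℚ.* Hstar k f n)
           × (Hstar 1 f n ℚ.< ℚ.1ℚ
              → (k : ℕ) → 1 ≤ k → k ≤ n
              → (ℚ.0ℚ ℚ.< Hstar k f n) × (Hstar k f n ℚ.< ℚ.1ℚ))
lemma2p1 n 2≤n f f-pos = part-i , part-ii
  where
    -- With these weights starSum k n is Hstar k f n by definition.
    open StarSum (λ i → recipℤ (eval f (+ i))) (λ {i} 1≤i → recipℤ-pos (f-pos i 1≤i))
    part-i : (k : ℕ) → 1 ≤ k → k ≤ n ∸ 1 → starSum (suc k) n < starSum 1 n * starSum k n
    part-i (suc k) _ _ = starSum-suc-< k n 2≤n
    part-ii : starSum 1 n < 1ℚ → (k : ℕ) → 1 ≤ k → k ≤ n → (0ℚ < starSum k n) × (starSum k n < 1ℚ)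
    part-ii H₁<1 (suc k) _ _ =
      starSum-pos (suc k) n (ℕP.<⇒≤ 2≤n) , ℚP.≤-<-trans (starSum-≤-starSum-one k n (ℚP.<⇒≤ H₁<1)) H₁<1
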